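{- Let $\mathfrak{D}=\langle \mathfrak{M}, \star\rangle$ be a class of dynamic models. The axiom schema $E\varphi \rightarrow (\mu\varphi \leftrightarrow [\star\varphi]\mu\top)$ is valid in $\mathfrak{D}$ for every propositional formula $\varphi \in \mathcal{L}_0$ iff for each $M = \langle W, \leq, v\rangle \in \mathfrak{M}$ and each $\varphi\in\mathcal{L}_0$, with $\star(M, \varphi) = \langle W, \leq_{\star \varphi}, v\rangle$, if $[\![\varphi]\!]\neq \emptyset$ then $Min_\leq [\![\varphi]\!] = Min_{\leq_{\star \varphi}} W$, i.e., $\star$ satisfies (Faith) in $\mathfrak{M}$.
   Context: Fix a set $P$ of propositional letters; $\mathcal{L}_0$ is the classical propositional language over $P$. A (well-founded) preference model is $M=\langle W,\leq,v\rangle$ with $W$ a set of worlds, $\leq$ a reflexive, transitive relation on $W$ whose strict part $<$ is well-founded, and $v:P\to 2^W$ a valuation; $\mathit{Mod}(\mathcal{L}_\leq)$ is the class of all such models. A dynamic operator is a map $\star:\mathit{Mod}(\mathcal{L}_\leq)\times\mathcal{L}_0\to\mathit{Mod}(\mathcal{L}_\leq)$ with $\star(M,\varphi)=\langle W,\leq_{\star\varphi},v\rangle$ (same worlds and valuation). The language $\mathcal{L}_\leq(\star)$ is built from $P$ with $\neg,\wedge$, the universal modality $A$ (with dual $E\varphi=\neg A\neg\varphi$), the modalities $[\leq]$, $[<]$ (dual $\langle<\rangle$), and formulas $[\star\varphi]\xi$ with $\varphi\in\mathcal{L}_0$. A dynamic model is $D=\langle M,\star\rangle$, with standard clauses for $A,[\leq],[<]$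 and $D,w\vDash[\star\varphi]\xi$ iff $\langle\star(M,\varphi),\star\rangle,w\vDash\xi$. For a class $\mathfrak{M}$ of preference models over which $\star$ is closed, $\mathfrak{D}=\langle\mathfrak{M},\star\rangle$ is the class of dynamic models $\langle M,\star\rangle$ with $M\in\mathfrak{M}$; a formula is valid in $\mathfrak{D}$ if true at every world of every such model. $[\![\varphi]\!]$ denotes the set of worlds of the model satisfying $\varphi$; $Min_\leq X=\{w\in X\mid$ there is no $w'\in X$ with $w'<w\}$. $\mu\varphi:=\varphi\wedge\neg\langle<\rangle\varphi$, which holds at $w$ iff $w\in Min_\leq[\![\varphi]\!]$. -}

module Defs where

open import Data.Bool using (Bool; T)
open import Data.Unit using (⊤)
open import Data.Product using (_×_; Σ; _,_)
open import Relation.Nullary using (¬_)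
open import Induction.WellFounded using (WellFounded)

Strict : {W : Set} → (W → W → Set) → W → W → Set
Strict _≤_ x y = (x ≤ y) × ¬ (y ≤ x)

record WFPreorder (W : Set) : Set₁ where
  field
    _≤_   : W → W → Set
    refl  : ∀ w → w ≤ w
    trans : ∀ {x y z} → x ≤ y → y ≤ z → x ≤ z
    wf    : WellFounded (Strict _≤_)

  _<_ : W → W → Set
  _<_ = Strict _≤_

-- Preference models over a set P of propositional letters.
-- A valuation v : P → 2^W is given as a characteristic function.

record PrefModel (P : Set) : Set₁ where
  field
    W   : Set
    ord : WFPreorder W
    v   : P → W → Bool
  open WFPreorder ord public

open PrefModel

withOrder : {P : Set} (M : PrefModel P) → WFPreorder (W M) → PrefModel P
withOrder M o = record { W = W M ; ord = o ; v = v M }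

data Form₀ (P : Set) : Set where
  atom : P → Form₀ P
  ⊤₀   : Form₀ P
  ¬₀_  : Form₀ P → Form₀ P
  _∧₀_ : Form₀ P → Form₀ P → Form₀ P

-- a dynamic operator: ⋆(M, φ) = ⟨W, ≤_{⋆φ}, v⟩
DynOp : Set → Set₁
DynOp P = (M : PrefModel P) → Form₀ P → WFPreorder (W M)

_⟪_⟫_ : {P : Set} → PrefModel P → DynOp P → Form₀ P → PrefModel P
M ⟪ ⋆ ⟫ φ = withOrder M (⋆ M φ)

data Form (P : Set) : Set where
  atom  : P → Form P
  ⊤'    : Form P
  ¬'_   : Form P → Form P
  _∧'_  : Form P → Form P → Form P
  A     : Form P → Form P
  [≤]   : Form P → Form P
  [<]   : Form P → Form P
  [⋆_]_ : Form₀ P → Form P → Form P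

E : {P : Set} → Form P → Form P
E φ = ¬' A (¬' φ)

⟨<⟩ : {P : Set} → Form P → Form P
⟨<⟩ φ = ¬' [<] (¬' φ)

_⇒'_ : {P : Set} → Form P → Form P → Form P
φ ⇒' ψ = ¬' (φ ∧' (¬' ψ))

_⇔'_ : {P : Set} → Form P → Form P → Form P
φ ⇔' ψ = (φ ⇒' ψ) ∧' (ψ ⇒' φ)

emb : {P : Set} → Form₀ P → Form P
emb (atom p)  = atom p
emb ⊤₀        = ⊤'
emb (¬₀ φ)    = ¬' emb φ
emb (φ ∧₀ ψ)  = emb φ ∧' emb ψ

μ : {P : Set} → Form P → Form P
μ φ = φ ∧' (¬' ⟨<⟩ φ)

⟦_⟧₀ : {P : Set} {M : PrefModel P} → Form₀ P → W M → Set
⟦_⟧₀ {M = M} (atom p) w = T (v M p w)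
⟦ ⊤₀ ⟧₀ w      = ⊤
⟦_⟧₀ {M = M} (¬₀ φ) w   = ¬ ⟦_⟧₀ {M = M} φ w
⟦_⟧₀ {M = M} (φ ∧₀ ψ) w = ⟦_⟧₀ {M = M} φ w × ⟦_⟧₀ {M = M} ψ w

-- satisfaction in the dynamic model ⟨M, ⋆⟩;
-- accessibility for [≤]/[<] goes to better (smaller) worlds
Sat : {P : Set} → DynOp P → (M : PrefModel P) → W M → Form P → Set
Sat ⋆ M w (atom p)   = T (v M p w)
Sat ⋆ M w ⊤'         = ⊤
Sat ⋆ M w (¬' φ)     = ¬ Sat ⋆ M w φ
Sat ⋆ M w (φ ∧' ψ)   = Sat ⋆ M w φ × Sat ⋆ M w ψ
Sat ⋆ M w (A φ)      = ∀ w' → Sat ⋆ M w' φ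
Sat ⋆ M w ([≤] φ)    = ∀ w' → _≤_ M w' w → Sat ⋆ M w' φ
Sat ⋆ M w ([<] φ)    = ∀ w' → _<_ M w' w → Sat ⋆ M w' φ
Sat ⋆ M w ([⋆ φ ] ξ) = Sat ⋆ (M ⟪ ⋆ ⟫ φ) w ξ

Closed : {P : Set} → (PrefModel P → Set) → DynOp P → Set₁
Closed 𝔐 ⋆ = ∀ M φ → 𝔐 M → 𝔐 (M ⟪ ⋆ ⟫ φ)

Valid : {P : Set} → (PrefModel P → Set) → DynOp P → Form P → Set₁
Valid 𝔐 ⋆ ξ = ∀ M → 𝔐 M → ∀ w → Sat ⋆ M w ξ

Min : {W : Set} → WFPreorder W → (W → Set) → W → Set
Min o X w = X w × ¬ (Σ _ λ w' → X w' × WFPreorder._<_ o w' w)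

Faith : {P : Set} → (PrefModel P → Set) → DynOp P → Set₁
Faith 𝔐 ⋆ = ∀ M → 𝔐 M → ∀ φ →
  ¬ (∀ w → ¬ ⟦_⟧₀ {M = M} φ w) →
  ∀ w → (Min (ord M) (⟦_⟧₀ {M = M} φ) w → Min (⋆ M φ) (λ _ → ⊤) w)
      × (Min (⋆ M φ) (λ _ → ⊤) w → Min (ord M) (⟦_⟧₀ {M = M} φ) w)

-- Both sides of the axiom are read classically: μφ says that w is ≤-minimal
-- in ⟦φ⟧ and [⋆φ]μ⊤ that w is ≤⋆φ-minimal in W, so the instance of the axiom
-- at w states exactly the (Faith) biconditional at w under the hypothesis
-- ⟦φ⟧ ≠ ∅. The only classical step, turning ¬(a ∧ ¬b) into a → b, is sound
-- because both minimality statements are ¬¬-stable: ⟦φ⟧ is decidable and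
-- the rest of each statement is a negation.
module Submission where

open import Defs
open import Data.Product using (_×_; _,_; Σ)
open import Data.Product.Function.NonDependent.Propositional using (_×-⇔_)
open import Data.Unit using (⊤; tt)
open import Function.Bundles using (_⇔_; mk⇔; module Equivalence)
open import Function.Construct.Composition using (_⇔-∘_)
open import Function.Construct.Symmetry using (⇔-sym)
open import Function.Properties.Equivalence using () renaming (refl to ⇔-refl)
open import Function.Related.TypeIsomorphisms using (→-cong-⇔; ¬-cong-⇔)
open import Relation.Nullary using (¬_; Dec; yes)
open import Relation.Nullary.Decidable using (map; T?; ¬?; _×-dec_; decidable-stable)
open import Relation.Nullary.Negation using (Stable; negated-stable)

open PrefModel
open Equivalence using (to; from)

×-stable : {A B : Set} → Stable A → Stable B → Stable (A × B)
×-stable stableA stableB ¬¬ab =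
  stableA (λ ¬a → ¬¬ab (λ (a , _) → ¬a a)) ,
  stableB (λ ¬b → ¬¬ab (λ (_ , b) → ¬b b))

¬[A×¬B]⇔[A→B] : {A B : Set} → Stable B → (¬ (A × ¬ B)) ⇔ (A → B)
¬[A×¬B]⇔[A→B] stableB =
  mk⇔ (λ ¬[a×¬b] a → stableB (λ ¬b → ¬[a×¬b] (a , ¬b)))
      (λ a→b (a , ¬b) → ¬b (a→b a))

¬¬∀¬⇔¬∃ : {W : Set} {R S : W → Set} →
  (¬ ¬ (∀ u → R u → ¬ S u)) ⇔ (¬ (Σ W λ u → S u × R u))
¬¬∀¬⇔¬∃ = mk⇔ (λ ¬¬∀¬ (u , s , r) → ¬¬∀¬ (λ ∀¬ → ∀¬ u r s))
              (λ ¬∃ ¬∀¬ → ¬∀¬ (λ u r s → ¬∃ (u , s , r)))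

Min-cong : {W : Set} (o : WFPreorder W) {X Y : W → Set} →
  (∀ w → X w ⇔ Y w) → ∀ w → Min o X w ⇔ Min o Y w
Min-cong o X⇔Y w = X⇔Y w ×-⇔ ¬-cong-⇔ (mk⇔
  (λ (u , x , u<w) → u , to (X⇔Y u) x , u<w)
  (λ (u , y , u<w) → u , from (X⇔Y u) y , u<w))

⟦⟧₀-dec : {P : Set} (M : PrefModel P) → ∀ φ w → Dec (⟦_⟧₀ {M = M} φ w)
⟦⟧₀-dec M (atom p) w = T? (v M p w)
⟦⟧₀-dec M ⊤₀       w = yes tt
⟦⟧₀-dec M (¬₀ φ)   w = ¬? (⟦⟧₀-dec M φ w)
⟦⟧₀-dec M (φ ∧₀ ψ) w = ⟦⟧₀-dec M φ w ×-dec ⟦⟧₀-dec M ψ w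

module _ {P : Set} (⋆ : DynOp P) (M : PrefModel P) where

  Sat-emb : ∀ φ w → Sat ⋆ M w (emb φ) ⇔ ⟦_⟧₀ {M = M} φ w
  Sat-emb (atom p) w = ⇔-refl
  Sat-emb ⊤₀       w = ⇔-refl
  Sat-emb (¬₀ φ)   w = ¬-cong-⇔ (Sat-emb φ w)
  Sat-emb (φ ∧₀ ψ) w = Sat-emb φ w ×-⇔ Sat-emb ψ w

  Sat-emb-stable : ∀ φ w → Stable (Sat ⋆ M w (emb φ))
  Sat-emb-stable φ w = decidable-stable (map (⇔-sym (Sat-emb φ w)) (⟦⟧₀-dec M φ w))

  Sat-E-emb : ∀ φ w → Sat ⋆ M w (E (emb φ)) ⇔ (¬ (∀ u → ¬ ⟦_⟧₀ {M = M} φ u))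
  Sat-E-emb φ w = ¬-cong-⇔ (mk⇔
    (λ ∀¬sat u d → ∀¬sat u (from (Sat-emb φ u) d))
    (λ ∀¬⟦⟧ u s → ∀¬⟦⟧ u (to (Sat-emb φ u) s)))

  Sat-μ : ∀ ξ w → Sat ⋆ M w (μ ξ) ⇔ Min (ord M) (λ u → Sat ⋆ M u ξ) w
  Sat-μ ξ w = ⇔-refl ×-⇔ ¬¬∀¬⇔¬∃

  Sat-μ-stable : ∀ ξ w → Stable (Sat ⋆ M w ξ) → Stable (Sat ⋆ M w (μ ξ))
  Sat-μ-stable ξ w stable = ×-stable stable negated-stable

  Sat-⇒' : ∀ ξ ζ w → Stable (Sat ⋆ M w ζ) →
    Sat ⋆ M w (ξ ⇒' ζ) ⇔ (Sat ⋆ M w ξ → Sat ⋆ M w ζ)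
  Sat-⇒' ξ ζ w = ¬[A×¬B]⇔[A→B]

  Sat-⇔' : ∀ ξ ζ w → Stable (Sat ⋆ M w ξ) → Stable (Sat ⋆ M w ζ) →
    Sat ⋆ M w (ξ ⇔' ζ) ⇔ ((Sat ⋆ M w ξ → Sat ⋆ M w ζ) × (Sat ⋆ M w ζ → Sat ⋆ M w ξ))
  Sat-⇔' ξ ζ w stableξ stableζ = Sat-⇒' ξ ζ w stableζ ×-⇔ Sat-⇒' ζ ξ w stableξ

  Sat-⇔'-stable : ∀ ξ ζ w → Stable (Sat ⋆ M w (ξ ⇔' ζ))
  Sat-⇔'-stable ξ ζ w = ×-stable negated-stable negated-stable

module _ {P : Set} (⋆ : DynOp P) (M : PrefModel P) (φ : Form₀ P) (w : W M) where

  ⟦φ⟧ : W M → Set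
  ⟦φ⟧ = ⟦_⟧₀ {M = M} φ

  Sat-μ-emb : Sat ⋆ M w (μ (emb φ)) ⇔ Min (ord M) ⟦φ⟧ w
  Sat-μ-emb = Min-cong (ord M) (Sat-emb ⋆ M φ) w ⇔-∘ Sat-μ ⋆ M (emb φ) w

  Sat-[⋆]μ⊤ : Sat ⋆ M w ([⋆ φ ] μ ⊤') ⇔ Min (⋆ M φ) (λ _ → ⊤) w
  Sat-[⋆]μ⊤ = Sat-μ ⋆ (M ⟪ ⋆ ⟫ φ) ⊤' w

  faith-axiom⇔faith : Sat ⋆ M w (E (emb φ) ⇒' (μ (emb φ) ⇔' ([⋆ φ ] μ ⊤'))) ⇔
    (¬ (∀ u → ¬ ⟦φ⟧ u) →
      (Min (ord M) ⟦φ⟧ w → Min (⋆ M φ) (λ _ → ⊤) w) ×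
      (Min (⋆ M φ) (λ _ → ⊤) w → Min (ord M) ⟦φ⟧ w))
  faith-axiom⇔faith =
    →-cong-⇔ (Sat-E-emb ⋆ M φ w)
      (  (→-cong-⇔ Sat-μ-emb Sat-[⋆]μ⊤ ×-⇔ →-cong-⇔ Sat-[⋆]μ⊤ Sat-μ-emb)
      ⇔-∘ Sat-⇔' ⋆ M (μ (emb φ)) ([⋆ φ ] μ ⊤') w
            (Sat-μ-stable ⋆ M (emb φ) w (Sat-emb-stable ⋆ M φ w))
            (Sat-μ-stable ⋆ (M ⟪ ⋆ ⟫ φ) ⊤' w (λ _ → tt)))
    ⇔-∘ Sat-⇒' ⋆ M (E (emb φ)) (μ (emb φ) ⇔' ([⋆ φ ] μ ⊤')) w
          (Sat-⇔'-stable ⋆ M (μ (emb φ)) ([⋆ φ ] μ ⊤') w)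

-- The correspondence holds model by model and world by world.
proposition21 : {P : Set} (𝔐 : PrefModel P → Set) (⋆ : DynOp P) →
    Closed 𝔐 ⋆ →
    ((∀ (φ : Form₀ P) → Valid 𝔐 ⋆ (E (emb φ) ⇒' (μ (emb φ) ⇔' ([⋆ φ ] μ ⊤'))))
    ⇔ Faith 𝔐 ⋆)
proposition21 𝔐 ⋆ _ = mk⇔
  (λ valid M 𝔐M φ nonempty w →
    to (faith-axiom⇔faith ⋆ M φ w) (valid φ M 𝔐M w) nonempty)
  (λ faith φ M 𝔐M w →
    from (faith-axiom⇔faith ⋆ M φ w) (λ nonempty → faith M 𝔐M φ nonempty w))
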